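{- Let $t$ be a $\lambda\mu$T-term in normal form (with respect to $\to$) such that $\emptyset;\emptyset\vdash t:\mathbb N$. Then $t\equiv\overline n$ for some $n\in\mathbb N$.
   Context: The $\lambda\mu$T-calculus. Types: $\rho,\sigma,\tau ::= \mathbb N \mid \sigma\to\tau$. Over infinite sets of $\lambda$-variables $x,y,\dots$ and $\mu$-variables $\alpha,\beta,\dots$, terms and commands: $t,r,s ::= x \mid \lambda x{:}\rho.r \mid ts \mid \mu\alpha{:}\rho.c \mid 0 \mid \mathsf S\,t \mid \mathsf{nrec}_\rho\ r\ s\ t$, $c ::= [\alpha]t$. $\mathrm{FCV}(t)$: free $\mu$-variables. Numerals $\overline n := \mathsf S^n 0$. Typing judgments $\Gamma;\Delta\vdash t:\rho$, $\Gamma;\Delta\vdash c$ generated by: $x:\rho\in\Gamma\Rightarrow\Gamma;\Delta\vdash x:\rho$; $\Gamma,x{:}\sigma;\Delta\vdash t:\tau\Rightarrow\Gamma;\Delta\vdash\lambda x{:}\sigma.t:\sigma\to\tau$; $\Gamma;\Delta\vdash t:\sigma\to\tau$, $\Gamma;\Delta\vdash s:\sigma\Rightarrow\Gamma;\Delta\vdash ts:\tau$; $\Gamma;\Delta\vdash0:\mathbb N$; $\Gamma;\Delta\vdash t:\mathbb N\Rightarrow\Gamma;\Delta\vdash\mathsf S\,t:\mathbb N$; $\Gamma;\Delta\vdash r:\rho$, $\Gamma;\Delta\vdash s:\mathbb N\to\rho\to\rho$, $\Gamma;\Delta\vdash t:\mathbb N\Rightarrow\Gamma;\Delta\vdash\mathsf{nrec}_\rho\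 r\ s\ t:\rho$; $\Gamma;\Delta,\alpha{:}\rho\vdash c\Rightarrow\Gamma;\Delta\vdash\mu\alpha{:}\rho.c:\rho$; $\Gamma;\Delta\vdash t:\rho$, $\alpha:\rho\in\Delta\Rightarrow\Gamma;\Delta\vdash[\alpha]t$. Contexts $E ::= \Box \mid E\,t \mid \mathsf S\,E \mid \mathsf{nrec}\ r\ s\ E$. Structural substitution $t[\alpha:=\beta E]$ replaces recursively every subcommand $[\alpha]q$ by $[\beta]E[q[\alpha:=\beta E]]$ (capture-avoiding). Reduction $\to$ is the compatible closure (on terms and commands) of: $(\lambda x.t)r \to t[x:=r]$; $\mathsf S(\mu\alpha.c)\to \mu\alpha.c[\alpha:=\alpha(\mathsf S\Box)]$; $(\mu\alpha.c)s\to\mu\alpha.c[\alpha:=\alpha(\Box s)]$; $\mu\alpha.[\alpha]t\to t$ if $\alpha\notin\mathrm{FCV}(t)$; $[\alpha]\mu\beta.c\to c[\beta:=\alpha\,\Box]$; $\mathsf{nrec}\ r\ s\ 0\to r$; $\mathsf{nrec}\ r\ s\ (\mathsf S\,\overline n)\to s\ \overline n\ (\mathsf{nrec}\ r\ s\ \overline n)$; $\mathsf{nrec}\ r\ s\ (\mu\alpha.c)\to\mu\alpha.c[\alpha:=\alpha(\mathsf{nrec}\ r\ s\ \Box)]$. A term is in normal form if no $\to$ step applies to it. -}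

module Defs where

-- The λμT-calculus (Church-style), with de Bruijn indices for both
-- λ-variables and μ-variables (α-equivalence is syntactic equality,
-- capture-avoidance is handled by index shifting).

open import Data.Nat using (ℕ; zero; suc; pred; _≟_)
open import Data.Bool using (Bool; true; false; _∨_)
open import Data.List using (List; []; _∷_)
open import Relation.Nullary using (¬_; yes; no)
open import Relation.Binary.PropositionalEquality using (_≡_)

infixr 7 _⇒_

data Ty : Set where
  `ℕ  : Ty
  _⇒_ : Ty → Ty → Ty

mutual
  data Tm : Set where
    var  : ℕ → Tm
    lam  : Ty → Tm → Tm
    app  : Tm → Tm → Tm
    mu   : Ty → Cmd → Tm
    zer  : Tm
    S    : Tm → Tm
    nrec : Ty → Tm → Tm → Tm → Tm

  data Cmd : Set where
    named : ℕ → Tm → Cmd          -- [α]t  (α a μ-index)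

num : ℕ → Tm
num zero    = zer
num (suc n) = S (num n)

data Ctx : Set where
  hole  : Ctx
  appC  : Ctx → Tm → Ctx
  SC    : Ctx → Ctx
  nrecC : Ty → Tm → Tm → Ctx → Ctx

plug : Ctx → Tm → Tm
plug hole          q = q
plug (appC E t)    q = app (plug E q) t
plug (SC E)        q = S (plug E q)
plug (nrecC ρ r s E) q = nrec ρ r s (plug E q)

liftR : (ℕ → ℕ) → ℕ → ℕ
liftR f zero    = zero
liftR f (suc i) = suc (f i)

mutual
  renλ : (ℕ → ℕ) → Tm → Tm
  renλ f (var i)        = var (f i)
  renλ f (lam ρ t)      = lam ρ (renλ (liftR f) t)
  renλ f (app t s)      = app (renλ f t) (renλ f s)
  renλ f (mu ρ c)       = mu ρ (renλc f c)
  renλ f zer            = zer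
  renλ f (S t)          = S (renλ f t)
  renλ f (nrec ρ r s t) = nrec ρ (renλ f r) (renλ f s) (renλ f t)

  renλc : (ℕ → ℕ) → Cmd → Cmd
  renλc f (named a t) = named a (renλ f t)

mutual
  renμ : (ℕ → ℕ) → Tm → Tm
  renμ f (var i)        = var i
  renμ f (lam ρ t)      = lam ρ (renμ f t)
  renμ f (app t s)      = app (renμ f t) (renμ f s)
  renμ f (mu ρ c)       = mu ρ (renμc (liftR f) c)
  renμ f zer            = zer
  renμ f (S t)          = S (renμ f t)
  renμ f (nrec ρ r s t) = nrec ρ (renμ f r) (renμ f s) (renμ f t)

  renμc : (ℕ → ℕ) → Cmd → Cmd
  renμc f (named a t) = named (f a) (renμ f t)

renλCtx : (ℕ → ℕ) → Ctx → Ctx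
renλCtx f hole            = hole
renλCtx f (appC E t)      = appC (renλCtx f E) (renλ f t)
renλCtx f (SC E)          = SC (renλCtx f E)
renλCtx f (nrecC ρ r s E) = nrecC ρ (renλ f r) (renλ f s) (renλCtx f E)

renμCtx : (ℕ → ℕ) → Ctx → Ctx
renμCtx f hole            = hole
renμCtx f (appC E t)      = appC (renμCtx f E) (renμ f t)
renμCtx f (SC E)          = SC (renμCtx f E)
renμCtx f (nrecC ρ r s E) = nrecC ρ (renμ f r) (renμ f s) (renμCtx f E)

extsλ : (ℕ → Tm) → ℕ → Tm
extsλ σ zero    = var zero
extsλ σ (suc i) = renλ suc (σ i)

mutual
  sub : (ℕ → Tm) → Tm → Tm
  sub σ (var i)        = σ i
  sub σ (lam ρ t)      = lam ρ (sub (extsλ σ) t)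
  sub σ (app t s)      = app (sub σ t) (sub σ s)
  sub σ (mu ρ c)       = mu ρ (subc (λ i → renμ suc (σ i)) c)
  sub σ zer            = zer
  sub σ (S t)          = S (sub σ t)
  sub σ (nrec ρ r s t) = nrec ρ (sub σ r) (sub σ s) (sub σ t)

  subc : (ℕ → Tm) → Cmd → Cmd
  subc σ (named a t) = named a (sub σ t)

single : Tm → ℕ → Tm
single r zero    = r
single r (suc i) = var i

_[0:=_] : Tm → Tm → Tm
t [0:= r ] = sub (single r) t

-- structural substitution  t[k := j E]: every subcommand [k]q becomes
-- [j]E[q[k := j E]]  (k, j μ-indices in the same scope as t)

mutual
  ssub : ℕ → ℕ → Ctx → Tm → Tm
  ssub k j E (var i)        = var i
  ssub k j E (lam ρ t)      = lam ρ (ssub k j (renλCtx suc E) t)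
  ssub k j E (app t s)      = app (ssub k j E t) (ssub k j E s)
  ssub k j E (mu ρ c)       = mu ρ (ssubc (suc k) (suc j) (renμCtx suc E) c)
  ssub k j E zer            = zer
  ssub k j E (S t)          = S (ssub k j E t)
  ssub k j E (nrec ρ r s t) = nrec ρ (ssub k j E r) (ssub k j E s) (ssub k j E t)

  ssubc : ℕ → ℕ → Ctx → Cmd → Cmd
  ssubc k j E (named a t) with a ≟ k
  ... | yes _ = named j (plug E (ssub k j E t))
  ... | no  _ = named a (ssub k j E t)

mutual
  occμ : ℕ → Tm → Bool
  occμ a (var i)        = false
  occμ a (lam ρ t)      = occμ a t
  occμ a (app t s)      = occμ a t ∨ occμ a s
  occμ a (mu ρ c)       = occμc (suc a) c
  occμ a zer            = false
  occμ a (S t)          = occμ a t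
  occμ a (nrec ρ r s t) = occμ a r ∨ occμ a s ∨ occμ a t

  occμc : ℕ → Cmd → Bool
  occμc a (named b t) with b ≟ a
  ... | yes _ = true
  ... | no  _ = occμ a t

infix 4 _⟶_ _⟶c_

mutual
  data _⟶_ : Tm → Tm → Set where
    β      : ∀ {ρ t r} → app (lam ρ t) r ⟶ t [0:= r ]
    μS     : ∀ {ρ c} → S (mu ρ c) ⟶ mu ρ (ssubc 0 0 (SC hole) c)
    μapp   : ∀ {σ τ c s} →
             app (mu (σ ⇒ τ) c) s ⟶ mu τ (ssubc 0 0 (appC hole (renμ suc s)) c)
    μη     : ∀ {ρ t} → occμ 0 t ≡ false → mu ρ (named 0 t) ⟶ renμ pred t
    nrec0  : ∀ {ρ r s} → nrec ρ r s zer ⟶ r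
    nrecS  : ∀ {ρ r s n} →
             nrec ρ r s (S (num n)) ⟶ app (app s (num n)) (nrec ρ r s (num n))
    nrecμ  : ∀ {ρ σ r s c} →
             nrec ρ r s (mu σ c)
               ⟶ mu ρ (ssubc 0 0 (nrecC ρ (renμ suc r) (renμ suc s) hole) c)
    ξlam   : ∀ {ρ t t'} → t ⟶ t' → lam ρ t ⟶ lam ρ t'
    ξappL  : ∀ {t t' s} → t ⟶ t' → app t s ⟶ app t' s
    ξappR  : ∀ {t s s'} → s ⟶ s' → app t s ⟶ app t s'
    ξmu    : ∀ {ρ c c'} → c ⟶c c' → mu ρ c ⟶ mu ρ c'
    ξS     : ∀ {t t'} → t ⟶ t' → S t ⟶ S t'
    ξnrec1 : ∀ {ρ r r' s t} → r ⟶ r' → nrec ρ r s t ⟶ nrec ρ r' s t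
    ξnrec2 : ∀ {ρ r s s' t} → s ⟶ s' → nrec ρ r s t ⟶ nrec ρ r s' t
    ξnrec3 : ∀ {ρ r s t t'} → t ⟶ t' → nrec ρ r s t ⟶ nrec ρ r s t'

  data _⟶c_ : Cmd → Cmd → Set where
    -- [α]μβ.c → c[β:=α□]   (β is index 0 inside c, α is index a+1 there;
    -- afterwards index 0 no longer occurs and indices are lowered)
    μnamed : ∀ {a ρ c} →
             named a (mu ρ c) ⟶c renμc pred (ssubc 0 (suc a) hole c)
    ξnamed : ∀ {a t t'} → t ⟶ t' → named a t ⟶c named a t'

Normal : Tm → Set
Normal t = ∀ t' → ¬ (t ⟶ t')

infix 4 _∋_∶_

data _∋_∶_ : List Ty → ℕ → Ty → Set where
  here  : ∀ {Γ ρ} → (ρ ∷ Γ) ∋ zero ∶ ρ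
  there : ∀ {Γ ρ σ i} → Γ ∋ i ∶ ρ → (σ ∷ Γ) ∋ suc i ∶ ρ

infix 4 _︔_⊢_∶_ _︔_⊢c_

mutual
  data _︔_⊢_∶_ (Γ Δ : List Ty) : Tm → Ty → Set where
    ⊢var  : ∀ {i ρ} → Γ ∋ i ∶ ρ → Γ ︔ Δ ⊢ var i ∶ ρ
    ⊢lam  : ∀ {σ τ t} → (σ ∷ Γ) ︔ Δ ⊢ t ∶ τ → Γ ︔ Δ ⊢ lam σ t ∶ σ ⇒ τ
    ⊢app  : ∀ {σ τ t s} → Γ ︔ Δ ⊢ t ∶ σ ⇒ τ → Γ ︔ Δ ⊢ s ∶ σ → Γ ︔ Δ ⊢ app t s ∶ τ
    ⊢zer  : Γ ︔ Δ ⊢ zer ∶ `ℕ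
    ⊢S    : ∀ {t} → Γ ︔ Δ ⊢ t ∶ `ℕ → Γ ︔ Δ ⊢ S t ∶ `ℕ
    ⊢nrec : ∀ {ρ r s t} → Γ ︔ Δ ⊢ r ∶ ρ → Γ ︔ Δ ⊢ s ∶ `ℕ ⇒ ρ ⇒ ρ →
            Γ ︔ Δ ⊢ t ∶ `ℕ → Γ ︔ Δ ⊢ nrec ρ r s t ∶ ρ
    ⊢mu   : ∀ {ρ c} → Γ ︔ (ρ ∷ Δ) ⊢c c → Γ ︔ Δ ⊢ mu ρ c ∶ ρ

  data _︔_⊢c_ (Γ Δ : List Ty) : Cmd → Set where
    ⊢named : ∀ {a ρ t} → Γ ︔ Δ ⊢ t ∶ ρ → Δ ∋ a ∶ ρ → Γ ︔ Δ ⊢c named a t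

module Submission where

-- The argument is a canonical-forms analysis.  First, a term that is normal
-- and has no free λ-variables (its μ-context Δ is arbitrary) is a numeral,
-- a λ-abstraction or a μ-abstraction: variables are untypable in the empty
-- λ-context, and an application, successor or recursor whose head/argument
-- had one of these shapes would itself be a redex (β, μapp, μS, nrec0,
-- nrecS, nrecμ).  Normality is inherited by the subterms needed for this
-- induction through the compatibility rules.
--
-- Second, a closed μ-abstraction of type ℕ is never normal: its body is
-- [α]u with α the bound variable and u a normal term of type ℕ in the empty
-- λ-context, so u is a numeral (and μα.[α]n̄ is a μη-redex, since numerals
-- have no free μ-variables) or a μ-abstraction (and [α]μβ.c is a redex).

open import Defs
open import Data.Nat using (ℕ; zero; suc)
open import Data.List using ([])
open import Data.Product using (∃; _,_)
open import Data.Bool using (false)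
open import Data.Empty using (⊥; ⊥-elim)
open import Relation.Binary.PropositionalEquality using (_≡_; refl)

data Canonical : Tm → Ty → Set where
  numeral : ∀ n → Canonical (num n) `ℕ
  μ-abs   : ∀ {ρ c} → Canonical (mu ρ c) ρ
  λ-abs   : ∀ {σ τ t} → Canonical (lam σ t) (σ ⇒ τ)

normal-inside : ∀ (F : Tm → Tm) {u} →
                (∀ {u'} → u ⟶ u' → F u ⟶ F u') → Normal (F u) → Normal u
normal-inside F compat nf u' step = nf (F u') (compat step)

-- Numerals contain no μ-variables, so μη applies to μα.[α]n̄.
numeral-μ-free : ∀ a n → occμ a (num n) ≡ false
numeral-μ-free a zero    = refl
numeral-μ-free a (suc n) = numeral-μ-free a n

canonical : ∀ {Δ t ρ} → [] ︔ Δ ⊢ t ∶ ρ → Normal t → Canonical t ρ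
canonical (⊢var ())    nf
canonical (⊢lam _)     nf = λ-abs
canonical (⊢mu _)      nf = μ-abs
canonical ⊢zer         nf = numeral 0
canonical (⊢app {s = s} ⊢t _) nf
  with canonical ⊢t (normal-inside (λ x → app x s) ξappL nf)
... | μ-abs = ⊥-elim (nf _ μapp)
... | λ-abs = ⊥-elim (nf _ β)
canonical (⊢S ⊢t) nf
  with canonical ⊢t (normal-inside S ξS nf)
... | numeral n = numeral (suc n)
... | μ-abs     = ⊥-elim (nf _ μS)
canonical (⊢nrec {ρ = ρ} {r = r} {s = s} _ _ ⊢t) nf
  with canonical ⊢t (normal-inside (nrec ρ r s) ξnrec3 nf)
... | numeral zero    = ⊥-elim (nf _ nrec0)
... | numeral (suc n) = ⊥-elim (nf _ nrecS)
... | μ-abs           = ⊥-elim (nf _ nrecμ)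

closed-μ-not-normal : ∀ {c} → [] ︔ [] ⊢ mu `ℕ c ∶ `ℕ → Normal (mu `ℕ c) → ⊥
closed-μ-not-normal (⊢mu (⊢named _ (there ())))
closed-μ-not-normal (⊢mu (⊢named ⊢u here)) nf
  with canonical ⊢u (normal-inside (λ x → mu `ℕ (named 0 x)) (λ st → ξmu (ξnamed st)) nf)
... | numeral n = nf _ (μη (numeral-μ-free 0 n))
... | μ-abs     = nf _ (ξmu μnamed)

theorem3p24 : ∀ (t : Tm) → [] ︔ [] ⊢ t ∶ `ℕ → Normal t → ∃ λ (n : ℕ) → t ≡ num n
theorem3p24 t ⊢t nf with canonical ⊢t nf
... | numeral n = n , refl
... | μ-abs     = ⊥-elim (closed-μ-not-normal ⊢t nf)
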